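{- The element $b_0$ is central in the Lie algebra $(\mathfrak{Lie}(B),\{ -,-\}_A)$, i.e. $\{\phi,b_0\}_A=0$ for all $\phi\in\mathfrak{Lie}(B)$.
   Context: Let $B=\{b_0,b_1,b_2,\dots\}$, $\mathbb{Q}\langle B\rangle$ the free associative $\mathbb{Q}$-algebra on $B$, and $\mathfrak{Lie}(B)\subset\mathbb{Q}\langle B\rangle$ the free Lie algebra on $B$. For a word $w=b_0^{m_1}b_{k_1}\cdots b_0^{m_d}b_{k_d}b_0^{m_{d+1}}$ ($d\ge1$, $k_i\ge1$, $m_i\ge0$), $\mathbf{k}=(k_1,\dots,k_d)$ and $\mathbf{l}\in\mathbb{Z}_{>0}^d$, let $w(\mathbf{l})$ be obtained by replacing each $b_{k_i}$ by $b_{l_i}$, $|\mathbf{k}|=\sum k_i$, $\binom{\mathbf{k}-1}{\mathbf{l}-1}=\prod_i\binom{k_i-1}{l_i-1}$, $\mathbf{l}\le\mathbf{k}$ componentwise. Let $\partial_w$ be the derivation of $\mathbb{Q}\langle B\rangle$ with $\partial_w(b_0)=0$ and $\partial_w(b_i)=\sum_{\mathbf{l}\le\mathbf{k}}(-1)^{|\mathbf{k}|+|\mathbf{l}|}\binom{\mathbf{k}-1}{\mathbf{l}-1}[b_{i+|\mathbf{k}|-|\mathbf{l}|},w(\mathbf{l})]$ for $i\ge1$; if $w=b_0^m$ ($m\ge1$), $\partial_w(b_0)=0$ and $\partial_w(b_i)=[b_i,w]$; extend linearly in $w$. The Lie bracket on $\mathfrak{Lie}(B)$ is $\{\psi_1,\psi_2\}_A=\partial_{\psi_1}(\psi_2)-\partial_{\psi_2}(\psi_1)+[\psi_1,\psi_2]$.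 -}

module Defs where

open import Data.Nat as ℕ using (ℕ; zero; suc; _∸_)
open import Data.Nat.Combinatorics using (_C_)
open import Data.Integer using (+_)
open import Data.Rational using (ℚ; 0ℚ; 1ℚ; _+_; _*_; -_; _/_)
open import Data.List using (List; []; _∷_; _++_; map; concatMap; upTo; null)
open import Data.List.Properties using (≡-dec)
open import Data.Product using (_×_; _,_; Σ)
open import Data.Bool using (Bool; if_then_else_)
open import Relation.Nullary using (does)
open import Relation.Binary.PropositionalEquality using (_≡_)

-- Words in the alphabet B = {b_0, b_1, ...}: b_i is encoded as i.
Word : Set
Word = List ℕ

-- Elements of Q<B>: finite formal Q-linear combinations of words
-- (a representation; equality is coefficientwise, see _≈_).
Poly : Set
Poly = List (ℚ × Word)

0P : Poly
0P = []

infixl 6 _⊕_ _⊖_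
infixl 7 _⊗_ _·_

_⊕_ : Poly → Poly → Poly
p ⊕ q = p ++ q

_·_ : ℚ → Poly → Poly
c · p = map (λ { (a , w) → (c * a , w) }) p

_⊖_ : Poly → Poly → Poly
p ⊖ q = p ⊕ (- 1ℚ) · q

_⊗_ : Poly → Poly → Poly
p ⊗ q = concatMap (λ { (a , u) → map (λ { (b , v) → (a * b , u ++ v) }) q }) p

comm : Poly → Poly → Poly
comm p q = p ⊗ q ⊖ q ⊗ p

word : Word → Poly
word w = (1ℚ , w) ∷ []

gen : ℕ → Poly
gen i = word (i ∷ [])

coeff : Poly → Word → ℚ
coeff [] w = 0ℚ
coeff ((a , u) ∷ p) w =
  if does (≡-dec ℕ._≟_ u w) then a + coeff p w else coeff p w

_≈_ : Poly → Poly → Set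
p ≈ q = ∀ w → coeff p w ≡ coeff q w

derivWord : (ℕ → Poly) → Word → Poly
derivWord δ [] = []
derivWord δ (x ∷ w) = δ x ⊗ word w ⊕ word (x ∷ []) ⊗ derivWord δ w

deriv : (ℕ → Poly) → Poly → Poly
deriv δ p = concatMap (λ { (a , w) → a · derivWord δ w }) p

sgn : ℕ → ℚ
sgn zero = 1ℚ
sgn (suc n) = - sgn n

ℕtoℚ : ℕ → ℚ
ℕtoℚ n = (+ n) / 1

-- For w = b_0^{m_1} b_{k_1} ... b_{k_d} b_0^{m_{d+1}}, the list of triples
-- ( (-1)^{|k|+|l|} binom(k-1,l-1) , w(l) , |k|-|l| ) for all 1 ≤ l ≤ k.
-- A letter suc k stands for k_i = k+1; l ranges over l_i = suc l, l = 0..k.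
substs : Word → List (ℚ × Word × ℕ)
substs [] = (1ℚ , [] , 0) ∷ []
substs (zero ∷ w) = map (λ { (c , u , s) → (c , zero ∷ u , s) }) (substs w)
substs (suc k ∷ w) =
  concatMap (λ { (c , u , s) →
    map (λ l → (c * sgn (k ∸ l) * ℕtoℚ (k C l) , suc l ∷ u , s ℕ.+ (k ∸ l)))
        (upTo (suc k)) })
    (substs w)

isZero : ℕ → Bool
isZero zero = Bool.true
isZero (suc _) = Bool.false

allZero : Word → Bool
allZero [] = Bool.true
allZero (zero ∷ w) = allZero w
allZero (suc _ ∷ w) = Bool.false

δword : Word → ℕ → Poly
δword w zero = 0P
δword w (suc i) =
  if allZero w
  then (if null w then 0P else comm (gen (suc i)) (word w))
  else concatMap (λ { (c , u , s) → c · comm (gen (suc i ℕ.+ s)) (word u) }) (substs w)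

δpoly : Poly → ℕ → Poly
δpoly ψ i = concatMap (λ { (a , w) → a · δword w i }) ψ

∂ : Poly → Poly → Poly
∂ ψ = deriv (δpoly ψ)

bracketA : Poly → Poly → Poly
bracketA ψ₁ ψ₂ = ∂ ψ₁ ψ₂ ⊖ ∂ ψ₂ ψ₁ ⊕ comm ψ₁ ψ₂

-- Free Lie algebra Lie(B) ⊂ Q<B>: the Q-span of iterated commutators of generators.
data LieTerm : Set where
  lgen  : ℕ → LieTerm
  ladd  : LieTerm → LieTerm → LieTerm
  lscal : ℚ → LieTerm → LieTerm
  lbr   : LieTerm → LieTerm → LieTerm

⟦_⟧ : LieTerm → Poly
⟦ lgen i ⟧ = gen i
⟦ ladd s t ⟧ = ⟦ s ⟧ ⊕ ⟦ t ⟧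
⟦ lscal c t ⟧ = c · ⟦ t ⟧
⟦ lbr s t ⟧ = comm ⟦ s ⟧ ⟦ t ⟧

InLie : Poly → Set
InLie φ = Σ LieTerm (λ t → ⟦ t ⟧ ≈ φ)

-- ∂_φ kills b₀ by definition, so {φ, b₀}_A = −∂_{b₀}(φ) + [φ, b₀]. On generators
-- ∂_{b₀}(b_i) = [b_i, b₀] (for i = 0 both sides vanish), and a derivation is determined by its
-- values on generators, so ∂_{b₀} is the inner derivation [−, b₀] on all of Q⟨B⟩ and the two
-- terms cancel.
module Submission where

open import Defs
open import Data.Nat as ℕ using (ℕ; zero; suc)
open import Data.Rational using (ℚ; 0ℚ; 1ℚ; _+_; _*_; _-_; -_)
open import Data.Rational.Properties using (*-identityˡ)
open import Data.Rational.Solver using (module +-*-Solver)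
open import Data.List using ([]; _∷_; _++_)
open import Data.List.Properties using (≡-dec)
open import Data.Product using (_,_)
open import Data.Bool using (Bool; true; false; if_then_else_)
open import Level using (0ℓ)
open import Relation.Nullary using (does)
open import Relation.Binary.Bundles using (Setoid)
import Relation.Binary.Reasoning.Setoid
open import Relation.Binary.PropositionalEquality
  using (_≡_; refl; sym; trans; cong; cong₂; module ≡-Reasoning)

open +-*-Solver using (solve; _:=_; _:+_; _:*_; _:-_; con)

𝟙[_≡_] : Word → Word → ℚ
𝟙[ u ≡ w ] = if does (≡-dec ℕ._≟_ u w) then 1ℚ else 0ℚ

coeff-∷ : ∀ a u p w → coeff ((a , u) ∷ p) w ≡ a * 𝟙[ u ≡ w ] + coeff p w
coeff-∷ a u p w with does (≡-dec ℕ._≟_ u w)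
... | true  = solve 2 (λ a c → a :+ c := a :* con 1ℚ :+ c) refl a (coeff p w)
... | false = solve 2 (λ a c → c := a :* con 0ℚ :+ c) refl a (coeff p w)

coeff-⊕ : ∀ p q w → coeff (p ⊕ q) w ≡ coeff p w + coeff q w
coeff-⊕ [] q w = solve 1 (λ c → c := con 0ℚ :+ c) refl (coeff q w)
coeff-⊕ ((a , u) ∷ p) q w = begin
  coeff ((a , u) ∷ p ⊕ q) w
    ≡⟨ coeff-∷ a u (p ⊕ q) w ⟩
  a * 𝟙[ u ≡ w ] + coeff (p ⊕ q) w
    ≡⟨ cong (a * 𝟙[ u ≡ w ] +_) (coeff-⊕ p q w) ⟩
  a * 𝟙[ u ≡ w ] + (coeff p w + coeff q w)
    ≡⟨ solve 3 (λ x y z → x :+ (y :+ z) := (x :+ y) :+ z)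
               refl (a * 𝟙[ u ≡ w ]) (coeff p w) (coeff q w) ⟩
  (a * 𝟙[ u ≡ w ] + coeff p w) + coeff q w
    ≡⟨ cong (_+ coeff q w) (coeff-∷ a u p w) ⟨
  coeff ((a , u) ∷ p) w + coeff q w
    ∎
  where open ≡-Reasoning

coeff-· : ∀ c p w → coeff (c · p) w ≡ c * coeff p w
coeff-· c [] w = solve 1 (λ c → con 0ℚ := c :* con 0ℚ) refl c
coeff-· c ((a , u) ∷ p) w = begin
  coeff ((c * a , u) ∷ c · p) w
    ≡⟨ coeff-∷ (c * a) u (c · p) w ⟩
  c * a * 𝟙[ u ≡ w ] + coeff (c · p) w
    ≡⟨ cong (c * a * 𝟙[ u ≡ w ] +_) (coeff-· c p w) ⟩
  c * a * 𝟙[ u ≡ w ] + c * coeff p w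
    ≡⟨ solve 4 (λ c a i x → c :* a :* i :+ c :* x := c :* (a :* i :+ x))
               refl c a 𝟙[ u ≡ w ] (coeff p w) ⟩
  c * (a * 𝟙[ u ≡ w ] + coeff p w)
    ≡⟨ cong (c *_) (coeff-∷ a u p w) ⟨
  c * coeff ((a , u) ∷ p) w
    ∎
  where open ≡-Reasoning

coeff-word-⊖ : ∀ u v w → coeff (word u ⊖ word v) w ≡ 𝟙[ u ≡ w ] - 𝟙[ v ≡ w ]
coeff-word-⊖ u v w = begin
  coeff (word u ⊖ word v) w
    ≡⟨ coeff-∷ 1ℚ u ((- 1ℚ * 1ℚ , v) ∷ []) w ⟩
  1ℚ * 𝟙[ u ≡ w ] + coeff ((- 1ℚ * 1ℚ , v) ∷ []) w
    ≡⟨ cong (1ℚ * 𝟙[ u ≡ w ] +_) (coeff-∷ (- 1ℚ * 1ℚ) v [] w) ⟩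
  1ℚ * 𝟙[ u ≡ w ] + (- 1ℚ * 1ℚ * 𝟙[ v ≡ w ] + 0ℚ)
    ≡⟨ solve 2 (λ i j → con 1ℚ :* i :+ (con (- 1ℚ * 1ℚ) :* j :+ con 0ℚ) := i :- j)
               refl 𝟙[ u ≡ w ] 𝟙[ v ≡ w ] ⟩
  𝟙[ u ≡ w ] - 𝟙[ v ≡ w ]
    ∎
  where open ≡-Reasoning

≈-setoid : Setoid 0ℓ 0ℓ
≈-setoid = record
  { Carrier       = Poly
  ; _≈_           = _≈_
  ; isEquivalence = record
    { refl  = λ _ → refl
    ; sym   = λ p≈q w → sym (p≈q w)
    ; trans = λ p≈q q≈r w → trans (p≈q w) (q≈r w)
    }
  }

module ≈-Reasoning = Relation.Binary.Reasoning.Setoid ≈-setoid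

⊕-cong : ∀ p p′ q q′ → p ≈ p′ → q ≈ q′ → (p ⊕ q) ≈ (p′ ⊕ q′)
⊕-cong p p′ q q′ p≈p′ q≈q′ w =
  trans (coeff-⊕ p q w) (trans (cong₂ _+_ (p≈p′ w) (q≈q′ w)) (sym (coeff-⊕ p′ q′ w)))

·-cong : ∀ c p q → p ≈ q → (c · p) ≈ (c · q)
·-cong c p q p≈q w = trans (coeff-· c p w) (trans (cong (c *_) (p≈q w)) (sym (coeff-· c q w)))

⊖-cong : ∀ p p′ q q′ → p ≈ p′ → q ≈ q′ → (p ⊖ q) ≈ (p′ ⊖ q′)
⊖-cong p p′ q q′ p≈p′ q≈q′ = ⊕-cong p p′ (- 1ℚ · q) (- 1ℚ · q′) p≈p′ (·-cong (- 1ℚ) q q′ q≈q′)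

⊖-⊕-cancel : ∀ p q → (p ⊖ q ⊕ q) ≈ p
⊖-⊕-cancel p q w = begin
  coeff (p ⊖ q ⊕ q) w
    ≡⟨ coeff-⊕ (p ⊖ q) q w ⟩
  coeff (p ⊖ q) w + coeff q w
    ≡⟨ cong (_+ coeff q w) (coeff-⊕ p (- 1ℚ · q) w) ⟩
  coeff p w + coeff (- 1ℚ · q) w + coeff q w
    ≡⟨ cong (λ x → coeff p w + x + coeff q w) (coeff-· (- 1ℚ) q w) ⟩
  coeff p w + - 1ℚ * coeff q w + coeff q w
    ≡⟨ solve 2 (λ x y → x :+ con (- 1ℚ) :* y :+ y := x) refl (coeff p w) (coeff q w) ⟩
  coeff p w
    ∎
  where open ≡-Reasoning

word-⊖-self : ∀ u → (word u ⊖ word u) ≈ 0P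
word-⊖-self u w = trans (coeff-word-⊖ u u w) (solve 1 (λ i → i :- i := con 0ℚ) refl 𝟙[ u ≡ w ])

word-⊖-telescope : ∀ u v t → ((word u ⊖ word v) ⊕ (word t ⊖ word u)) ≈ (word t ⊖ word v)
word-⊖-telescope u v t w = begin
  coeff ((word u ⊖ word v) ⊕ (word t ⊖ word u)) w
    ≡⟨ coeff-⊕ (word u ⊖ word v) (word t ⊖ word u) w ⟩
  coeff (word u ⊖ word v) w + coeff (word t ⊖ word u) w
    ≡⟨ cong₂ _+_ (coeff-word-⊖ u v w) (coeff-word-⊖ t u w) ⟩
  (𝟙[ u ≡ w ] - 𝟙[ v ≡ w ]) + (𝟙[ t ≡ w ] - 𝟙[ u ≡ w ])
    ≡⟨ solve 3 (λ i j k → (i :- j) :+ (k :- i) := k :- j)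
               refl 𝟙[ u ≡ w ] 𝟙[ v ≡ w ] 𝟙[ t ≡ w ] ⟩
  𝟙[ t ≡ w ] - 𝟙[ v ≡ w ]
    ≡⟨ coeff-word-⊖ t v w ⟨
  coeff (word t ⊖ word v) w
    ∎
  where open ≡-Reasoning

coeff-gen-⊗-[] : ∀ x p → coeff (gen x ⊗ p) [] ≡ 0ℚ
coeff-gen-⊗-[] x [] = refl
coeff-gen-⊗-[] x (_ ∷ p) = coeff-gen-⊗-[] x p

coeff-gen-⊗-∷ : ∀ x p y v → coeff (gen x ⊗ p) (y ∷ v) ≡ (if x ℕ.≡ᵇ y then coeff p v else 0ℚ)
coeff-gen-⊗-∷ x [] y v with x ℕ.≡ᵇ y
... | true  = refl
... | false = refl
coeff-gen-⊗-∷ x ((b , u) ∷ p) y v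
  with x ℕ.≡ᵇ y | does (≡-dec ℕ._≟_ u v) | coeff-gen-⊗-∷ x p y v
... | true  | true  | ih = cong₂ _+_ (*-identityˡ b) ih
... | true  | false | ih = ih
... | false | _     | ih = ih

gen-⊗-cong : ∀ x p q → p ≈ q → (gen x ⊗ p) ≈ (gen x ⊗ q)
gen-⊗-cong x p q p≈q [] = trans (coeff-gen-⊗-[] x p) (sym (coeff-gen-⊗-[] x q))
gen-⊗-cong x p q p≈q (y ∷ v) =
  trans (coeff-gen-⊗-∷ x p y v) (trans (prefixed (x ℕ.≡ᵇ y)) (sym (coeff-gen-⊗-∷ x q y v)))
  where
  prefixed : (b : Bool) → (if b then coeff p v else 0ℚ) ≡ (if b then coeff q v else 0ℚ)
  prefixed true  = p≈q v
  prefixed false = refl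

comm-∷-gen : ∀ a u p c →
  comm ((a , u) ∷ p) (gen c) ≈ (a · comm (word u) (gen c) ⊕ comm p (gen c))
comm-∷-gen a u p c w = begin
  coeff (comm ((a , u) ∷ p) (gen c)) w
    ≡⟨ coeff-∷ (a * 1ℚ) (u ++ c ∷ []) (p ⊗ gen c ⊕ ((a′ , c ∷ u) ∷ -c⊗p)) w ⟩
  a * 1ℚ * I + coeff (p ⊗ gen c ⊕ ((a′ , c ∷ u) ∷ -c⊗p)) w
    ≡⟨ cong (a * 1ℚ * I +_) (trans (coeff-⊕ (p ⊗ gen c) ((a′ , c ∷ u) ∷ -c⊗p) w)
                                   (cong (P +_) (coeff-∷ a′ (c ∷ u) -c⊗p w))) ⟩
  a * 1ℚ * I + (P + (a′ * J + Q))
    ≡⟨ solve 5 (λ a I J P Q → a :* con 1ℚ :* I :+ (P :+ (con (- 1ℚ) :* (con 1ℚ :* a) :* J :+ Q))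
                            := a :* (I :- J) :+ (P :+ Q)) refl a I J P Q ⟩
  a * (I - J) + (P + Q)
    ≡⟨ cong₂ _+_ (cong (a *_) (coeff-word-⊖ (u ++ c ∷ []) (c ∷ u) w))
                 (coeff-⊕ (p ⊗ gen c) -c⊗p w) ⟨
  a * coeff (comm (word u) (gen c)) w + coeff (comm p (gen c)) w
    ≡⟨ cong (_+ coeff (comm p (gen c)) w) (coeff-· a (comm (word u) (gen c)) w) ⟨
  coeff (a · comm (word u) (gen c)) w + coeff (comm p (gen c)) w
    ≡⟨ coeff-⊕ (a · comm (word u) (gen c)) (comm p (gen c)) w ⟨
  coeff (a · comm (word u) (gen c) ⊕ comm p (gen c)) w
    ∎
  where
  open ≡-Reasoning
  a′ : ℚ
  a′ = - 1ℚ * (1ℚ * a)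
  -c⊗p : Poly
  -c⊗p = - 1ℚ · (gen c ⊗ p)
  I J P Q : ℚ
  I = 𝟙[ u ++ c ∷ [] ≡ w ]
  J = 𝟙[ c ∷ u ≡ w ]
  P = coeff (p ⊗ gen c) w
  Q = coeff -c⊗p w

δpoly-0≡0P : ∀ φ → δpoly φ 0 ≡ 0P
δpoly-0≡0P [] = refl
δpoly-0≡0P (_ ∷ φ) = δpoly-0≡0P φ

∂-gen0≡0P : ∀ φ → ∂ φ (gen 0) ≡ 0P
∂-gen0≡0P φ rewrite δpoly-0≡0P φ = refl

δ₀ : ℕ → Poly
δ₀ = δpoly (gen 0)

δ₀-⊗-word : ∀ x u → (δ₀ x ⊗ word u) ≈ (word (x ∷ 0 ∷ u) ⊖ word (0 ∷ x ∷ u))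
δ₀-⊗-word zero    u w = sym (word-⊖-self (0 ∷ 0 ∷ u) w)
δ₀-⊗-word (suc i) u w = refl

derivWord-δ₀≈comm : ∀ u → derivWord δ₀ u ≈ comm (word u) (gen 0)
derivWord-δ₀≈comm [] w = sym (word-⊖-self (0 ∷ []) w)
derivWord-δ₀≈comm (x ∷ u) = begin
  δ₀ x ⊗ word u ⊕ gen x ⊗ derivWord δ₀ u
    ≈⟨ ⊕-cong (δ₀ x ⊗ word u) (word (x ∷ 0 ∷ u) ⊖ word (0 ∷ x ∷ u))
              (gen x ⊗ derivWord δ₀ u) (gen x ⊗ comm (word u) (gen 0))
              (δ₀-⊗-word x u)
              (gen-⊗-cong x (derivWord δ₀ u) (comm (word u) (gen 0)) (derivWord-δ₀≈comm u)) ⟩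
  (word (x ∷ 0 ∷ u) ⊖ word (0 ∷ x ∷ u)) ⊕ (word (x ∷ u ++ 0 ∷ []) ⊖ word (x ∷ 0 ∷ u))
    ≈⟨ word-⊖-telescope (x ∷ 0 ∷ u) (0 ∷ x ∷ u) (x ∷ u ++ 0 ∷ []) ⟩
  comm (word (x ∷ u)) (gen 0)
    ∎
  where open ≈-Reasoning

∂-gen0≈comm-gen0 : ∀ φ → ∂ (gen 0) φ ≈ comm φ (gen 0)
∂-gen0≈comm-gen0 [] w = refl
∂-gen0≈comm-gen0 ((a , u) ∷ ψ) = begin
  a · derivWord δ₀ u ⊕ ∂ (gen 0) ψ
    ≈⟨ ⊕-cong (a · derivWord δ₀ u) (a · comm (word u) (gen 0)) (∂ (gen 0) ψ) (comm ψ (gen 0))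
              (·-cong a (derivWord δ₀ u) (comm (word u) (gen 0)) (derivWord-δ₀≈comm u))
              (∂-gen0≈comm-gen0 ψ) ⟩
  a · comm (word u) (gen 0) ⊕ comm ψ (gen 0)
    ≈⟨ comm-∷-gen a u ψ 0 ⟨
  comm ((a , u) ∷ ψ) (gen 0)
    ∎
  where open ≈-Reasoning

lemma2p4 : (φ : Poly) → InLie φ → bracketA φ (gen 0) ≈ 0P
lemma2p4 φ _ = begin
  bracketA φ (gen 0)
    ≡⟨ cong (λ d → d ⊖ ∂ (gen 0) φ ⊕ comm φ (gen 0)) (∂-gen0≡0P φ) ⟩
  0P ⊖ ∂ (gen 0) φ ⊕ comm φ (gen 0)
    ≈⟨ ⊕-cong (0P ⊖ ∂ (gen 0) φ) (0P ⊖ comm φ (gen 0)) (comm φ (gen 0)) (comm φ (gen 0))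
              (⊖-cong 0P 0P (∂ (gen 0) φ) (comm φ (gen 0)) (λ _ → refl) (∂-gen0≈comm-gen0 φ))
              (λ _ → refl) ⟩
  0P ⊖ comm φ (gen 0) ⊕ comm φ (gen 0)
    ≈⟨ ⊖-⊕-cancel 0P (comm φ (gen 0)) ⟩
  0P
    ∎
  where open ≈-Reasoning
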